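{- Let $n\geq1$ and $k=\lfloor n/2\rfloor$. Then \[\mathbf{R}:=\mathbf{X}_k-\mathbf{Y}_k-\mathbf{X}_{k+1}+\mathbf{Y}_{k+1}\] is a nonzero eigenvector of the adjacency matrix $A$ of $\mathrm{SR}(3,n)$ with eigenvalue $n-k-3=(n-6)/2$ if $n$ is even, and $n-k-2=(n-3)/2$ if $n$ is odd. Moreover, the linear span of the $\mathfrak{S}_3$-orbit $\{\tau(\mathbf{R}):\tau\in\mathfrak{S}_3\}$ has dimension $2$.
   Context: $\mathrm{SR}(3,n)$ has vertex set $V(3,n)=\{(i,j,k)\in\mathbb{Z}_{\ge 0}^3: i+j+k=n\}$, two vertices adjacent if they differ in exactly two coordinates; $A$ acts on $\mathbb{R}^N$, $N=\binom{n+2}{2}$, with standard basis $\{\mathbf{e}_{ijk}\}$, via $A\mathbf{e}_x=\sum_{y\sim x}\mathbf{e}_y$. For $0\le i\le n$: $\mathbf{X}_i=\sum_{j+k=n-i}\mathbf{e}_{ijk}$, $\mathbf{Y}_i=\sum_{a+k=n-i}\mathbf{e}_{aik}$, $\mathbf{Z}_i=\sum_{a+b=n-i}\mathbf{e}_{abi}$. The symmetric group $\mathfrak{S}_3$ acts on $V(3,n)$ by permuting coordinates and hence linearly on $\mathbb{R}^N$ by permuting the basis vectors accordingly; e.g. the 3-cycle acts by $\mathbf{X}_i\mapsto\mathbf{Y}_i\mapsto\mathbf{Z}_i\mapsto\mathbf{X}_i$ and a transposition by $\mathbf{X}_i\leftrightarrow\mathbf{Y}_i$, $\mathbf{Z}_i\mapsto\mathbf{Z}_i$.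 -}

module Defs where

open import Data.Nat as ℕ using (ℕ; zero; suc; _≟_)
open import Data.Nat.Properties as ℕP using (+-0-commutativeMonoid; +-identityʳ; +-assoc)
open import Data.Fin using (Fin) renaming (zero to 0F; suc to sF)
open import Data.Fin.Permutation using (Permutation′; _⟨$⟩ʳ_; _⟨$⟩ˡ_)
open import Data.List as List using (List; []; _∷_; upTo; mapMaybe; filter; length; concatMap)
open import Data.List.Base using (allFin)
open import Data.Maybe using (Maybe; just; nothing)
open import Data.Product using (Σ; ∃; _×_; _,_; proj₁; proj₂)
open import Data.Integer as ℤ using (ℤ)
open import Data.Rational as ℚ using (ℚ; 0ℚ; 1ℚ; _+_; _*_; _-_)
open import Relation.Binary.PropositionalEquality using (_≡_; refl; sym; trans; cong)
open import Relation.Nullary using (¬_; yes; no)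
open import Relation.Nullary.Decidable using (¬?)
import Algebra.Properties.CommutativeMonoid.Sum as MSum

1F 2F : Fin 3
1F = sF 0F
2F = sF (sF 0F)

Triple : Set
Triple = Fin 3 → ℕ

Vertex : ℕ → Set
Vertex n = Σ Triple (λ x → x 0F ℕ.+ x 1F ℕ.+ x 2F ≡ n)

mkTriple : ℕ → ℕ → ℕ → Triple
mkTriple a b c 0F = a
mkTriple a b c (sF 0F) = b
mkTriple a b c (sF (sF 0F)) = c

checkVertex : (n : ℕ) → Triple → Maybe (Vertex n)
checkVertex n x with x 0F ℕ.+ x 1F ℕ.+ x 2F ≟ n
... | yes p = just (x , p)
... | no _ = nothing

vertices : (n : ℕ) → List (Vertex n)
vertices n = mapMaybe (checkVertex n)
  (concatMap (λ a → concatMap (λ b → List.map (λ c → mkTriple a b c)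
     (upTo (suc n))) (upTo (suc n))) (upTo (suc n)))

diffCount : Triple → Triple → ℕ
diffCount x y = length (filter (λ c → ¬? (x c ≟ y c)) (allFin 3))

Adjacent : ∀ {n} → Vertex n → Vertex n → Set
Adjacent x y = diffCount (proj₁ x) (proj₁ y) ≡ 2

Vec : ℕ → Set
Vec n = Vertex n → ℚ

sumℚ : List ℚ → ℚ
sumℚ = List.foldr _+_ 0ℚ

adjOp : (n : ℕ) → Vec n → Vec n
adjOp n f x = sumℚ (List.map f
  (filter (λ y → diffCount (proj₁ x) (proj₁ y) ≟ 2) (vertices n)))

_≈V_ : ∀ {n} → Vec n → Vec n → Set
f ≈V g = ∀ x → f x ≡ g x

IsEigenvector : (n : ℕ) → Vec n → ℚ → Set
IsEigenvector n f λ' = adjOp n f ≈V (λ x → λ' * f x)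

Nonzero : ∀ {n} → Vec n → Set
Nonzero f = ∃ λ x → ¬ (f x ≡ 0ℚ)

indic : ℕ → ℕ → ℚ
indic a i with a ≟ i
... | yes _ = 1ℚ
... | no _ = 0ℚ

Xv Yv Zv : (n : ℕ) → ℕ → Vec n
Xv n i x = indic (proj₁ x 0F) i
Yv n i x = indic (proj₁ x 1F) i
Zv n i x = indic (proj₁ x 2F) i

_+V_ _-V_ : ∀ {n} → Vec n → Vec n → Vec n
(f +V g) x = f x + g x
(f -V g) x = f x - g x

Rvec : (n k : ℕ) → Vec n
Rvec n k = ((Xv n k -V Yv n k) -V Xv n (suc k)) +V Yv n (suc k)

-- Action of 𝔖₃ = Permutation′ 3 on vertices and vectors.
-- τ permutes coordinates: (τ·x)_{τ c} = x_c, and τ(e_x) = e_{τ·x},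
-- so (τ f)(y) = f(τ⁻¹·y) where (τ⁻¹·y)_c = y_{τ c}.

module NSum = MSum +-0-commutativeMonoid

sum3 : ∀ (x : Triple) → NSum.sum x ≡ x 0F ℕ.+ x 1F ℕ.+ x 2F
sum3 x = trans (cong (λ t → x 0F ℕ.+ (x 1F ℕ.+ t)) (+-identityʳ (x 2F)))
               (sym (+-assoc (x 0F) (x 1F) (x 2F)))

invAct : ∀ {n} → Permutation′ 3 → Vertex n → Vertex n
invAct τ (y , p) = (λ c → y (τ ⟨$⟩ʳ c)) ,
  trans (sym (sum3 (λ c → y (τ ⟨$⟩ʳ c))))
        (trans (sym (NSum.sum-permute y τ)) (trans (sum3 y) p))

actVec : ∀ {n} → Permutation′ 3 → Vec n → Vec n
actVec τ f y = f (invAct τ y)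

InSpan : ∀ {n} {I : Set} → (I → Vec n) → Vec n → Set
InSpan {n} {I} f v = ∃ λ (L : List (I × ℚ)) →
  v ≈V (λ x → sumℚ (List.map (λ p → proj₂ p * f (proj₁ p) x) L))

sumFin : ∀ {d} → (Fin d → ℚ) → ℚ
sumFin {d} g = sumℚ (List.map g (allFin d))

LinIndep : ∀ {n d} → (Fin d → Vec n) → Set
LinIndep {n} {d} b = ∀ (c : Fin d → ℚ) →
  (∀ x → sumFin (λ j → c j * b j x) ≡ 0ℚ) → ∀ j → c j ≡ 0ℚ

SpanDim : ∀ {n} {I : Set} → (I → Vec n) → ℕ → Set
SpanDim {n} f d = ∃ λ (b : Fin d → Vec n) →
  (∀ j → InSpan f (b j)) × LinIndep b × (∀ i → InSpan b (f i))

-- Write R(y) = d(y₀) − d(y₁) with the dipole d = δₖ − δₖ₊₁. On the simplex a + b + c = n a point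
-- y is adjacent to x = (p, q, r) exactly when one coordinate agrees, and two agreeing coordinates
-- force the third, so [y ∼ x] = [a = p] + [b = q] + [c = r] − 3[y = x]. Summing along the three
-- lines through x, the neighbour sum of y ↦ h(y₀) is h(p)(n − p − 2) + H(n − q) + H(n − r), where
-- H(m) = Σ_{t ≤ m} h(t). For h = d these partial sums are [m = k], so (AR)(x) = E(p) − E(q) with
-- E(t) = d(t)(n − t − 2) − [t = n − k]; since n − k is k or k + 1, E = μ·d for the claimed μ.
-- Every permuted copy of R is some d(y_i) − d(y_j), a combination of R and its image under the
-- transposition (1 2). These two are independent because their 2 × 2 minor at two explicit
-- vertices is nonzero, and the same minor exhibits a vertex where R does not vanish.

module Submission where

open import Defs

-- Local, so that the rational operators opened here do not clash with the integer ones in the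
-- statement of proposition2p8 below.
module _ where
  open import Data.Bool using (true; false; if_then_else_)
  open import Data.Empty using (⊥-elim)
  open import Data.Fin using (Fin) renaming (zero to 0F; suc to sF)
  open import Data.Fin.Permutation as Permutation using (Permutation′; _⟨$⟩ʳ_; transpose)
  open import Data.Integer as ℤ using (ℤ)
  open import Data.List as List using (List; []; _∷_; _++_; filter; mapMaybe; concatMap; applyUpTo; length)
  import Data.List.Properties as List
  open import Data.Maybe using (Maybe; just; nothing; maybe′)
  open import Data.Nat as ℕ using (ℕ; zero; suc; _≤_; _<_; s≤s; _∸_; _/_; _%_; _≟_; _≤?_; _<?_)
  import Data.Nat.Properties as ℕₚ
  open import Data.Nat.DivMod using (m≡m%n+[m/n]*n; m%n<n)
  open import Data.Product using (Σ; _×_; _,_; proj₁; proj₂)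
  open import Data.Rational as ℚ using (ℚ; 0ℚ; 1ℚ; _+_; _*_; _-_; -_)
  import Data.Rational.Properties as ℚₚ
  open import Data.Rational.Unnormalised as ℚᵘ using (mkℚᵘ; *≡*)
  import Data.Rational.Unnormalised.Properties as ℚᵘₚ
  open import Data.Sum using (_⊎_; inj₁; inj₂; [_,_]′)
  open import Function using (_∘_)
  open import Level using (0ℓ)
  open import Algebra.Bundles using (CommutativeRing)
  open import Relation.Binary.PropositionalEquality using (_≡_; _≢_; refl; sym; trans; cong; cong₂; subst; module ≡-Reasoning)
  open import Relation.Nullary using (¬_; Dec; yes; no; does)
  open import Relation.Nullary.Decidable using (¬?; dec-true; dec-false; dec⇒maybe)
  open import Algebra.Properties.CommutativeSemigroup (CommutativeRing.*-commutativeSemigroup ℚₚ.+-*-commutativeRing)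
    using () renaming (x∙yz≈y∙xz to x*[y*z]≡y*[x*z])
  open import Algebra.Properties.CommutativeSemigroup ℕₚ.+-commutativeSemigroup
    using () renaming (xy∙z≈xz∙y to m+n+o≡m+o+n; x∙yz≈y∙xz to m+[n+o]≡n+[m+o])
  open import Tactic.RingSolver using (solve; solve-∀)
  open import Tactic.RingSolver.Core.AlmostCommutativeRing using (AlmostCommutativeRing; fromCommutativeRing)

  open ≡-Reasoning

  ℚ-ring : AlmostCommutativeRing 0ℓ 0ℓ
  ℚ-ring = fromCommutativeRing ℚₚ.+-*-commutativeRing (λ x → dec⇒maybe (0ℚ ℚₚ.≟ x))

  *-distribˡ-- : ∀ x y z → x * (y - z) ≡ x * y - x * z
  *-distribˡ-- = solve-∀ ℚ-ring

  ℤ-ring : AlmostCommutativeRing 0ℓ 0ℓ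
  ℤ-ring = fromCommutativeRing ℤₚ.+-*-commutativeRing (λ x → dec⇒maybe (ℤ.0ℤ ℤₚ.≟ x))
    where import Data.Integer.Properties as ℤₚ

  fromℤ : ℤ → ℚ
  fromℤ z = z ℚ./ 1

  fromℤ≃ : ∀ z → ℚ.toℚᵘ (fromℤ z) ℚᵘ.≃ mkℚᵘ z 0
  fromℤ≃ z = ℚₚ.toℚᵘ-fromℚᵘ (mkℚᵘ z 0)

  fromℤ-+ : ∀ a b → fromℤ (a ℤ.+ b) ≡ fromℤ a + fromℤ b
  fromℤ-+ a b = ℚₚ.toℚᵘ-injective (ℚᵘₚ.≃-trans (fromℤ≃ (a ℤ.+ b)) (ℚᵘₚ.≃-trans (*≡* cross-multiplied)
    (ℚᵘₚ.≃-sym (ℚᵘₚ.≃-trans (ℚₚ.toℚᵘ-homo-+ (fromℤ a) (fromℤ b)) (ℚᵘₚ.+-cong (fromℤ≃ a) (fromℤ≃ b))))))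
    where
    cross-multiplied : (a ℤ.+ b) ℤ.* ℤ.+ 1 ≡ (a ℤ.* ℤ.+ 1 ℤ.+ b ℤ.* ℤ.+ 1) ℤ.* ℤ.+ 1
    cross-multiplied = solve (a ∷ b ∷ []) ℤ-ring

  fromℤ-neg : ∀ a → fromℤ (ℤ.- a) ≡ - fromℤ a
  fromℤ-neg a = ℚₚ.toℚᵘ-injective (ℚᵘₚ.≃-trans (fromℤ≃ (ℤ.- a))
    (ℚᵘₚ.≃-sym (ℚᵘₚ.≃-trans (ℚₚ.toℚᵘ-homo‿- (fromℤ a)) (ℚᵘₚ.-‿cong (fromℤ≃ a)))))

  fromℤ-- : ∀ a b → fromℤ (a ℤ.- b) ≡ fromℤ a - fromℤ b
  fromℤ-- a b = trans (fromℤ-+ a (ℤ.- b)) (cong (fromℤ a +_) (fromℤ-neg b))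

  fromℕ : ℕ → ℚ
  fromℕ m = fromℤ (ℤ.+ m)

  fromℕ-suc : ∀ m → fromℕ (suc m) ≡ 1ℚ + fromℕ m
  fromℕ-suc m = fromℤ-+ (ℤ.+ 1) (ℤ.+ m)

  fromℕ-∸ : ∀ {m n} → n ≤ m → fromℕ (m ∸ n) ≡ fromℕ m - fromℕ n
  fromℕ-∸ {m} {n} n≤m = begin
    fromℕ (m ∸ n)                  ≡⟨ add-sub (fromℕ (m ∸ n)) (fromℕ n) ⟩
    (fromℕ n + fromℕ (m ∸ n)) - fromℕ n ≡⟨ cong (_- fromℕ n) (fromℤ-+ (ℤ.+ n) (ℤ.+ (m ∸ n))) ⟨
    fromℕ (n ℕ.+ (m ∸ n)) - fromℕ n  ≡⟨ cong (λ t → fromℕ t - fromℕ n) (ℕₚ.m+[n∸m]≡n n≤m) ⟩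
    fromℕ m - fromℕ n               ∎
    where
    add-sub : ∀ x y → x ≡ (y + x) - y
    add-sub = solve-∀ ℚ-ring

  2ℚ 3ℚ : ℚ
  2ℚ = 1ℚ + 1ℚ
  3ℚ = 1ℚ + 2ℚ

  fromℤ-[m-n-c] : ∀ m n c → fromℤ (ℤ.+ m ℤ.- ℤ.+ n ℤ.- ℤ.+ c) ≡ fromℕ m - fromℕ n - fromℕ c
  fromℤ-[m-n-c] m n c =
    trans (fromℤ-- (ℤ.+ m ℤ.- ℤ.+ n) (ℤ.+ c)) (cong (_- fromℕ c) (fromℤ-- (ℤ.+ m) (ℤ.+ n)))

  -- Defined through does, so that 𝟙 (suc m ≟ suc t) and 𝟙 (m ≟ t) agree definitionally.
  𝟙 : {P : Set} → Dec P → ℚ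
  𝟙 P? = if does P? then 1ℚ else 0ℚ

  𝟙-yes : {P : Set} (P? : Dec P) → P → 𝟙 P? ≡ 1ℚ
  𝟙-yes P? p = cong (λ b → if b then 1ℚ else 0ℚ) (dec-true P? p)

  𝟙-no : {P : Set} (P? : Dec P) → ¬ P → 𝟙 P? ≡ 0ℚ
  𝟙-no P? ¬p = cong (λ b → if b then 1ℚ else 0ℚ) (dec-false P? ¬p)

  𝟙-cong : {P Q : Set} (P? : Dec P) (Q? : Dec Q) → (P → Q) → (Q → P) → 𝟙 P? ≡ 𝟙 Q?
  𝟙-cong (yes p) Q? P→Q Q→P = sym (𝟙-yes Q? (P→Q p))
  𝟙-cong (no ¬p) Q? P→Q Q→P = sym (𝟙-no Q? (¬p ∘ Q→P))

  sumBelow : ℕ → (ℕ → ℚ) → ℚ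
  sumBelow zero    h = 0ℚ
  sumBelow (suc N) h = h 0 + sumBelow N (h ∘ suc)

  sumBelow-cong : ∀ N {h h′ : ℕ → ℚ} → (∀ t → h t ≡ h′ t) → sumBelow N h ≡ sumBelow N h′
  sumBelow-cong zero    h≗h′ = refl
  sumBelow-cong (suc N) h≗h′ = cong₂ _+_ (h≗h′ 0) (sumBelow-cong N (h≗h′ ∘ suc))

  sumBelow-zero : ∀ N → sumBelow N (λ _ → 0ℚ) ≡ 0ℚ
  sumBelow-zero zero    = refl
  sumBelow-zero (suc N) = trans (ℚₚ.+-identityˡ _) (sumBelow-zero N)

  sumBelow-const : ∀ N x → sumBelow N (λ _ → x) ≡ fromℕ N * x
  sumBelow-const zero    x = sym (ℚₚ.*-zeroˡ x)
  sumBelow-const (suc N) x = begin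
    x + sumBelow N (λ _ → x)  ≡⟨ cong (x +_) (sumBelow-const N x) ⟩
    x + fromℕ N * x           ≡⟨ distrib x (fromℕ N) ⟩
    (1ℚ + fromℕ N) * x        ≡⟨ cong (_* x) (fromℕ-suc N) ⟨
    fromℕ (suc N) * x         ∎
    where
    distrib : ∀ x y → x + y * x ≡ (1ℚ + y) * x
    distrib = solve-∀ ℚ-ring

  sumBelow-+ : ∀ N (h h′ : ℕ → ℚ) → sumBelow N (λ t → h t + h′ t) ≡ sumBelow N h + sumBelow N h′
  sumBelow-+ zero    h h′ = refl
  sumBelow-+ (suc N) h h′ = begin
    (h 0 + h′ 0) + sumBelow N (λ t → h (suc t) + h′ (suc t))  ≡⟨ cong ((h 0 + h′ 0) +_) (sumBelow-+ N (h ∘ suc) (h′ ∘ suc)) ⟩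
    (h 0 + h′ 0) + (sumBelow N (h ∘ suc) + sumBelow N (h′ ∘ suc)) ≡⟨ interchange (h 0) (h′ 0) _ _ ⟩
    (h 0 + sumBelow N (h ∘ suc)) + (h′ 0 + sumBelow N (h′ ∘ suc)) ∎
    where
    interchange : ∀ a b c d → (a + b) + (c + d) ≡ (a + c) + (b + d)
    interchange = solve-∀ ℚ-ring

  sumBelow-*ˡ : ∀ N x (h : ℕ → ℚ) → sumBelow N (λ t → x * h t) ≡ x * sumBelow N h
  sumBelow-*ˡ zero    x h = sym (ℚₚ.*-zeroʳ x)
  sumBelow-*ˡ (suc N) x h =
    trans (cong (x * h 0 +_) (sumBelow-*ˡ N x (h ∘ suc))) (sym (ℚₚ.*-distribˡ-+ x (h 0) _))

  sumBelow-- : ∀ N (h h′ : ℕ → ℚ) → sumBelow N (λ t → h t - h′ t) ≡ sumBelow N h - sumBelow N h′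
  sumBelow-- N h h′ = begin
    sumBelow N (λ t → h t - h′ t)              ≡⟨ sumBelow-cong N (λ t → sub-as-add (h t) (h′ t)) ⟩
    sumBelow N (λ t → h t + (- 1ℚ) * h′ t)       ≡⟨ sumBelow-+ N h _ ⟩
    sumBelow N h + sumBelow N (λ t → (- 1ℚ) * h′ t) ≡⟨ cong (sumBelow N h +_) (sumBelow-*ˡ N (- 1ℚ) h′) ⟩
    sumBelow N h + (- 1ℚ) * sumBelow N h′        ≡⟨ sub-as-add (sumBelow N h) (sumBelow N h′) ⟨
    sumBelow N h - sumBelow N h′               ∎
    where
    sub-as-add : ∀ x y → x - y ≡ x + (- 1ℚ) * y
    sub-as-add = solve-∀ ℚ-ring

  sumBelow-factor : ∀ N x (F G : ℕ → ℚ) → sumBelow N (λ t → F t * (x * G t)) ≡ x * sumBelow N (λ t → F t * G t)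
  sumBelow-factor N x F G = trans (sumBelow-cong N λ t → x*[y*z]≡y*[x*z] (F t) x (G t)) (sumBelow-*ˡ N x (λ t → F t * G t))

  sumBelow-swap : ∀ N M (F : ℕ → ℕ → ℚ) →
    sumBelow N (λ a → sumBelow M (F a)) ≡ sumBelow M (λ b → sumBelow N (λ a → F a b))
  sumBelow-swap zero    M F = sym (sumBelow-zero M)
  sumBelow-swap (suc N) M F = begin
    sumBelow M (F 0) + sumBelow N (λ a → sumBelow M (F (suc a)))  ≡⟨ cong (sumBelow M (F 0) +_) (sumBelow-swap N M (F ∘ suc)) ⟩
    sumBelow M (F 0) + sumBelow M (λ b → sumBelow N (λ a → F (suc a) b)) ≡⟨ sumBelow-+ M (F 0) _ ⟨
    sumBelow M (λ b → F 0 b + sumBelow N (λ a → F (suc a) b))     ∎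

  sumBelow-pick : ∀ N m (F : ℕ → ℚ) → m < N → sumBelow N (λ t → 𝟙 (m ≟ t) * F t) ≡ F m
  sumBelow-pick (suc N) zero F _ = begin
    1ℚ * F 0 + sumBelow N (λ t → 0ℚ * F (suc t))
      ≡⟨ cong₂ _+_ (ℚₚ.*-identityˡ (F 0)) (sumBelow-cong N (λ t → ℚₚ.*-zeroˡ (F (suc t)))) ⟩
    F 0 + sumBelow N (λ _ → 0ℚ)                  ≡⟨ cong (F 0 +_) (sumBelow-zero N) ⟩
    F 0 + 0ℚ                                     ≡⟨ ℚₚ.+-identityʳ (F 0) ⟩
    F 0                                          ∎
  sumBelow-pick (suc N) (suc m) F (s≤s m<N) =
    trans (cong (_+ sumBelow N (λ t → 𝟙 (m ≟ t) * F (suc t))) (ℚₚ.*-zeroˡ (F 0)))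
      (trans (ℚₚ.+-identityˡ _) (sumBelow-pick N m (F ∘ suc) m<N))

  sumBelow-𝟙 : ∀ N m → sumBelow N (λ t → 𝟙 (m ≟ t)) ≡ 𝟙 (m <? N)
  sumBelow-𝟙 zero    m       = refl
  sumBelow-𝟙 (suc N) zero    = trans (cong (1ℚ +_) (sumBelow-zero N)) (ℚₚ.+-identityʳ 1ℚ)
  sumBelow-𝟙 (suc N) (suc m) = trans (ℚₚ.+-identityˡ _) (sumBelow-𝟙 N m)

  sumBelow-prefix : ∀ N m (F : ℕ → ℚ) → m < N → sumBelow N (λ t → 𝟙 (t ≤? m) * F t) ≡ sumBelow (suc m) F
  sumBelow-prefix (suc N) zero F _ = cong₂ _+_ (ℚₚ.*-identityˡ (F 0))
    (trans (sumBelow-cong N (λ t → ℚₚ.*-zeroˡ (F (suc t)))) (sumBelow-zero N))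
  sumBelow-prefix (suc N) (suc m) F (s≤s m<N) = cong₂ _+_ (ℚₚ.*-identityˡ (F 0)) (begin
    sumBelow N (λ t → 𝟙 (suc t ≤? suc m) * F (suc t))  ≡⟨ sumBelow-cong N (λ t →
                                                           cong (_* F (suc t)) (𝟙-cong (suc t ≤? suc m) (t ≤? m) ℕₚ.≤-pred s≤s)) ⟩
    sumBelow N (λ t → 𝟙 (t ≤? m) * F (suc t))          ≡⟨ sumBelow-prefix N m (F ∘ suc) m<N ⟩
    sumBelow (suc m) (F ∘ suc)                         ∎)

  sumBelow-truncate : ∀ n m (F : ℕ → ℚ) → m ≤ n →
    sumBelow (suc n) (λ t → 𝟙 (t ℕ.+ m ≤? n) * F t) ≡ sumBelow (suc (n ∸ m)) F
  sumBelow-truncate n m F m≤n = begin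
    sumBelow (suc n) (λ t → 𝟙 (t ℕ.+ m ≤? n) * F t)
      ≡⟨ sumBelow-cong (suc n) (λ t → cong (_* F t)
           (𝟙-cong (t ℕ.+ m ≤? n) (t ≤? n ∸ m) (ℕₚ.m+n≤o⇒m≤o∸n t) (ℕₚ.m≤o∸n⇒m+n≤o t m≤n))) ⟩
    sumBelow (suc n) (λ t → 𝟙 (t ≤? n ∸ m) * F t)
      ≡⟨ sumBelow-prefix (suc n) (n ∸ m) F (s≤s (ℕₚ.m∸n≤m n m)) ⟩
    sumBelow (suc (n ∸ m)) F  ∎

  sumBelow-pick-∸ : ∀ n m (G : ℕ → ℚ) →
    sumBelow (suc n) (λ t → 𝟙 (m ℕ.+ t ≟ n) * G t) ≡ 𝟙 (m ≤? n) * G (n ∸ m)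
  sumBelow-pick-∸ n m G with m ≤? n
  ... | yes m≤n = begin
    sumBelow (suc n) (λ t → 𝟙 (m ℕ.+ t ≟ n) * G t)
      ≡⟨ sumBelow-cong (suc n) (λ t → cong (_* G t) (𝟙-cong (m ℕ.+ t ≟ n) (n ∸ m ≟ t) (solves t) (solution t))) ⟩
    sumBelow (suc n) (λ t → 𝟙 (n ∸ m ≟ t) * G t)  ≡⟨ sumBelow-pick (suc n) (n ∸ m) G (s≤s (ℕₚ.m∸n≤m n m)) ⟩
    G (n ∸ m)                                    ≡⟨ ℚₚ.*-identityˡ (G (n ∸ m)) ⟨
    1ℚ * G (n ∸ m)                               ≡⟨ cong (_* G (n ∸ m)) (𝟙-yes (m ≤? n) m≤n) ⟨
    𝟙 (m ≤? n) * G (n ∸ m)                       ∎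
    where
    solves : ∀ t → m ℕ.+ t ≡ n → n ∸ m ≡ t
    solves t m+t≡n = trans (cong (_∸ m) (sym m+t≡n)) (ℕₚ.m+n∸m≡n m t)
    solution : ∀ t → n ∸ m ≡ t → m ℕ.+ t ≡ n
    solution t n∸m≡t = trans (cong (m ℕ.+_) (sym n∸m≡t)) (ℕₚ.m+[n∸m]≡n m≤n)
  ... | no m≰n = begin
    sumBelow (suc n) (λ t → 𝟙 (m ℕ.+ t ≟ n) * G t)
      ≡⟨ sumBelow-cong (suc n) (λ t → trans (cong (_* G t) (𝟙-no (m ℕ.+ t ≟ n) (unsolvable t))) (ℚₚ.*-zeroˡ (G t))) ⟩
    sumBelow (suc n) (λ _ → 0ℚ)  ≡⟨ sumBelow-zero (suc n) ⟩
    0ℚ                           ≡⟨ ℚₚ.*-zeroˡ (G (n ∸ m)) ⟨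
    0ℚ * G (n ∸ m)               ≡⟨ cong (_* G (n ∸ m)) (𝟙-no (m ≤? n) m≰n) ⟨
    𝟙 (m ≤? n) * G (n ∸ m)       ∎
    where
    unsolvable : ∀ t → m ℕ.+ t ≢ n
    unsolvable t m+t≡n = m≰n (subst (m ≤_) m+t≡n (ℕₚ.m≤m+n m t))

  dipole : ℕ → ℕ → ℚ
  dipole k t = 𝟙 (k ≟ t) - 𝟙 (suc k ≟ t)

  dipole-self : ∀ k → dipole k k ≡ 1ℚ
  dipole-self k = cong₂ _-_ (𝟙-yes (k ≟ k) refl) (𝟙-no (suc k ≟ k) ℕₚ.1+n≢n)

  dipole-suc : ∀ k → dipole k (suc k) ≡ - 1ℚ
  dipole-suc k = cong₂ _-_ (𝟙-no (k ≟ suc k) (ℕₚ.1+n≢n ∘ sym)) (𝟙-yes (suc k ≟ suc k) refl)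

  𝟙-telescope : ∀ k m → 𝟙 (k <? suc m) - 𝟙 (suc k <? suc m) ≡ 𝟙 (k ≟ m)
  𝟙-telescope zero    zero    = refl
  𝟙-telescope zero    (suc m) = refl
  𝟙-telescope (suc k) zero    = refl
  𝟙-telescope (suc k) (suc m) = 𝟙-telescope k m

  sumBelow-dipole : ∀ k m → sumBelow (suc m) (dipole k) ≡ 𝟙 (k ≟ m)
  sumBelow-dipole k m = begin
    sumBelow (suc m) (dipole k)
      ≡⟨ sumBelow-- (suc m) (λ t → 𝟙 (k ≟ t)) (λ t → 𝟙 (suc k ≟ t)) ⟩
    sumBelow (suc m) (λ t → 𝟙 (k ≟ t)) - sumBelow (suc m) (λ t → 𝟙 (suc k ≟ t))
      ≡⟨ cong₂ _-_ (sumBelow-𝟙 (suc m) k) (sumBelow-𝟙 (suc m) (suc k)) ⟩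
    𝟙 (k <? suc m) - 𝟙 (suc k <? suc m)
      ≡⟨ 𝟙-telescope k m ⟩
    𝟙 (k ≟ m)  ∎

  -- Sums over the simplex

  sumCube : ℕ → (ℕ → ℕ → ℕ → ℚ) → ℚ
  sumCube N F = sumBelow N λ a → sumBelow N λ b → sumBelow N λ c → F a b c

  sumCube-cong : ∀ N {F F′ : ℕ → ℕ → ℕ → ℚ} → (∀ a b c → F a b c ≡ F′ a b c) → sumCube N F ≡ sumCube N F′
  sumCube-cong N F≗F′ = sumBelow-cong N λ a → sumBelow-cong N λ b → sumBelow-cong N λ c → F≗F′ a b c

  sumCube-hom : (_∙_ : ℚ → ℚ → ℚ) → (∀ N h h′ → sumBelow N (λ t → h t ∙ h′ t) ≡ sumBelow N h ∙ sumBelow N h′) →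
    ∀ N F F′ → sumCube N (λ a b c → F a b c ∙ F′ a b c) ≡ sumCube N F ∙ sumCube N F′
  sumCube-hom _∙_ hom N F F′ =
    trans (sumBelow-cong N λ a → trans (sumBelow-cong N λ b → hom N (F a b) (F′ a b)) (hom N _ _)) (hom N _ _)

  sumCube-*ˡ : ∀ N x F → sumCube N (λ a b c → x * F a b c) ≡ x * sumCube N F
  sumCube-*ˡ N x F = trans (sumBelow-cong N λ a →
    trans (sumBelow-cong N λ b → sumBelow-*ˡ N x (F a b)) (sumBelow-*ˡ N x _)) (sumBelow-*ˡ N x _)

  onSimplex : ℕ → (ℕ → ℕ → ℕ → ℚ) → ℕ → ℕ → ℕ → ℚ
  onSimplex n G a b c = 𝟙 (a ℕ.+ b ℕ.+ c ≟ n) * G a b c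

  simplexSum : ℕ → (ℕ → ℕ → ℕ → ℚ) → ℚ
  simplexSum n G = sumCube (suc n) (onSimplex n G)

  𝟙-*-cong : ∀ {P : Set} (P? : Dec P) {x y} → (P → x ≡ y) → 𝟙 P? * x ≡ 𝟙 P? * y
  𝟙-*-cong (yes p) x≡y = cong (1ℚ *_) (x≡y p)
  𝟙-*-cong (no _) {x} {y} _ = trans (ℚₚ.*-zeroˡ x) (sym (ℚₚ.*-zeroˡ y))

  module _ {n : ℕ} where

    simplexSum-cong : ∀ {G G′ : ℕ → ℕ → ℕ → ℚ} → (∀ a b c → a ℕ.+ b ℕ.+ c ≡ n → G a b c ≡ G′ a b c) →
      simplexSum n G ≡ simplexSum n G′
    simplexSum-cong G≗G′ = sumCube-cong (suc n) λ a b c → 𝟙-*-cong (a ℕ.+ b ℕ.+ c ≟ n) (G≗G′ a b c)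

    simplexSum-+ : ∀ (G G′ : ℕ → ℕ → ℕ → ℚ) →
      simplexSum n (λ a b c → G a b c + G′ a b c) ≡ simplexSum n G + simplexSum n G′
    simplexSum-+ G G′ =
      trans (sumCube-cong (suc n) λ a b c → ℚₚ.*-distribˡ-+ (𝟙 (a ℕ.+ b ℕ.+ c ≟ n)) (G a b c) (G′ a b c))
            (sumCube-hom _+_ sumBelow-+ (suc n) (onSimplex n G) (onSimplex n G′))

    simplexSum-- : ∀ (G G′ : ℕ → ℕ → ℕ → ℚ) →
      simplexSum n (λ a b c → G a b c - G′ a b c) ≡ simplexSum n G - simplexSum n G′
    simplexSum-- G G′ =
      trans (sumCube-cong (suc n) λ a b c → *-distribˡ-- (𝟙 (a ℕ.+ b ℕ.+ c ≟ n)) (G a b c) (G′ a b c))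
            (sumCube-hom _-_ sumBelow-- (suc n) (onSimplex n G) (onSimplex n G′))

    simplexSum-*ˡ : ∀ x (G : ℕ → ℕ → ℕ → ℚ) → simplexSum n (λ a b c → x * G a b c) ≡ x * simplexSum n G
    simplexSum-*ˡ x G =
      trans (sumCube-cong (suc n) λ a b c → x*[y*z]≡y*[x*z] (𝟙 (a ℕ.+ b ℕ.+ c ≟ n)) x (G a b c))
            (sumCube-*ˡ (suc n) x (onSimplex n G))

    simplexSum-swap : ∀ (G : ℕ → ℕ → ℕ → ℚ) → simplexSum n G ≡ simplexSum n (λ a b c → G b a c)
    simplexSum-swap G =
      trans (sumBelow-swap (suc n) (suc n) (λ a b → sumBelow (suc n) (onSimplex n G a b)))
            (sumCube-cong (suc n) λ b a c → cong (λ s → 𝟙 (s ℕ.+ c ≟ n) * G a b c) (ℕₚ.+-comm a b))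

    simplexSum-restrictFirst : ∀ {p} (G : ℕ → ℕ → ℕ → ℚ) → p ≤ n →
      simplexSum n (λ a b c → 𝟙 (p ≟ a) * G a b c) ≡ sumBelow (suc n) λ b → sumBelow (suc n) (onSimplex n G p b)
    simplexSum-restrictFirst {p} G p≤n = begin
      simplexSum n (λ a b c → 𝟙 (p ≟ a) * G a b c)
        ≡⟨ sumBelow-cong (suc n) (λ a → trans
             (sumBelow-cong (suc n) λ b → sumBelow-factor (suc n) (𝟙 (p ≟ a)) (λ c → 𝟙 (a ℕ.+ b ℕ.+ c ≟ n)) (G a b))
             (sumBelow-*ˡ (suc n) (𝟙 (p ≟ a)) (face a))) ⟩
      sumBelow (suc n) (λ a → 𝟙 (p ≟ a) * sumBelow (suc n) (face a))
        ≡⟨ sumBelow-pick (suc n) p (λ a → sumBelow (suc n) (face a)) (s≤s p≤n) ⟩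
      sumBelow (suc n) (face p)  ∎
      where
      face : ℕ → ℕ → ℚ
      face a b = sumBelow (suc n) (onSimplex n G a b)

    simplexSum-firstFixed : ∀ {p} (h : ℕ → ℚ) → p ≤ n →
      simplexSum n (λ a b c → 𝟙 (p ≟ a) * h a) ≡ fromℕ (suc (n ∸ p)) * h p
    simplexSum-firstFixed {p} h p≤n = begin
      simplexSum n (λ a b c → 𝟙 (p ≟ a) * h a)
        ≡⟨ simplexSum-restrictFirst (λ a _ _ → h a) p≤n ⟩
      sumBelow (suc n) (λ b → sumBelow (suc n) (λ c → 𝟙 (p ℕ.+ b ℕ.+ c ≟ n) * h p))
        ≡⟨ sumBelow-cong (suc n) (λ b → sumBelow-pick-∸ n (p ℕ.+ b) (λ _ → h p)) ⟩
      sumBelow (suc n) (λ b → 𝟙 (p ℕ.+ b ≤? n) * h p)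
        ≡⟨ sumBelow-cong (suc n) (λ b → cong (λ s → 𝟙 (s ≤? n) * h p) (ℕₚ.+-comm p b)) ⟩
      sumBelow (suc n) (λ b → 𝟙 (b ℕ.+ p ≤? n) * h p)
        ≡⟨ sumBelow-truncate n p (λ _ → h p) p≤n ⟩
      sumBelow (suc (n ∸ p)) (λ _ → h p)
        ≡⟨ sumBelow-const (suc (n ∸ p)) (h p) ⟩
      fromℕ (suc (n ∸ p)) * h p  ∎

    simplexSum-point : ∀ {p q} (h : ℕ → ℚ) → p ℕ.+ q ≤ n →
      simplexSum n (λ a b c → 𝟙 (p ≟ a) * (𝟙 (q ≟ b) * h a)) ≡ h p
    simplexSum-point {p} {q} h p+q≤n = begin
      simplexSum n (λ a b c → 𝟙 (p ≟ a) * (𝟙 (q ≟ b) * h a))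
        ≡⟨ simplexSum-restrictFirst (λ a b _ → 𝟙 (q ≟ b) * h a) (ℕₚ.m+n≤o⇒m≤o p p+q≤n) ⟩
      sumBelow (suc n) (λ b → sumBelow (suc n) (λ c → 𝟙 (p ℕ.+ b ℕ.+ c ≟ n) * (𝟙 (q ≟ b) * h p)))
        ≡⟨ sumBelow-cong (suc n) (λ b → sumBelow-factor (suc n) (𝟙 (q ≟ b)) (λ c → 𝟙 (p ℕ.+ b ℕ.+ c ≟ n)) (λ _ → h p)) ⟩
      sumBelow (suc n) (λ b → 𝟙 (q ≟ b) * line b)
        ≡⟨ sumBelow-pick (suc n) q line (s≤s (ℕₚ.m+n≤o⇒n≤o p p+q≤n)) ⟩
      line q
        ≡⟨ sumBelow-pick-∸ n (p ℕ.+ q) (λ _ → h p) ⟩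
      𝟙 (p ℕ.+ q ≤? n) * h p
        ≡⟨ cong (_* h p) (𝟙-yes (p ℕ.+ q ≤? n) p+q≤n) ⟩
      1ℚ * h p
        ≡⟨ ℚₚ.*-identityˡ (h p) ⟩
      h p  ∎
      where
      line : ℕ → ℚ
      line b = sumBelow (suc n) (λ c → 𝟙 (p ℕ.+ b ℕ.+ c ≟ n) * h p)

    simplexSum-secondFixed : ∀ {q} (h : ℕ → ℚ) → q ≤ n →
      simplexSum n (λ a b c → 𝟙 (q ≟ b) * h a) ≡ sumBelow (suc (n ∸ q)) h
    simplexSum-secondFixed {q} h q≤n = begin
      simplexSum n (λ a b c → 𝟙 (q ≟ b) * h a)
        ≡⟨ sumBelow-cong (suc n) (λ a → sumBelow-cong (suc n) λ b →
             sumBelow-factor (suc n) (𝟙 (q ≟ b)) (λ c → 𝟙 (a ℕ.+ b ℕ.+ c ≟ n)) (λ _ → h a)) ⟩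
      sumBelow (suc n) (λ a → sumBelow (suc n) λ b → 𝟙 (q ≟ b) * line a b)
        ≡⟨ sumBelow-cong (suc n) (λ a → sumBelow-pick (suc n) q (line a) (s≤s q≤n)) ⟩
      sumBelow (suc n) (λ a → line a q)
        ≡⟨ sumBelow-cong (suc n) (λ a → sumBelow-pick-∸ n (a ℕ.+ q) (λ _ → h a)) ⟩
      sumBelow (suc n) (λ a → 𝟙 (a ℕ.+ q ≤? n) * h a)
        ≡⟨ sumBelow-truncate n q h q≤n ⟩
      sumBelow (suc (n ∸ q)) h  ∎
      where
      line : ℕ → ℕ → ℚ
      line a b = sumBelow (suc n) (λ c → 𝟙 (a ℕ.+ b ℕ.+ c ≟ n) * h a)

    simplexSum-thirdFixed : ∀ {r} (h : ℕ → ℚ) → r ≤ n →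
      simplexSum n (λ a b c → 𝟙 (r ≟ c) * h a) ≡ sumBelow (suc (n ∸ r)) h
    simplexSum-thirdFixed {r} h r≤n = begin
      simplexSum n (λ a b c → 𝟙 (r ≟ c) * h a)
        ≡⟨ sumBelow-cong (suc n) (λ a → sumBelow-cong (suc n) λ b → sumBelow-cong (suc n) λ c →
             x*[y*z]≡y*[x*z] (𝟙 (a ℕ.+ b ℕ.+ c ≟ n)) (𝟙 (r ≟ c)) (h a)) ⟩
      sumBelow (suc n) (λ a → sumBelow (suc n) λ b → sumBelow (suc n) λ c → 𝟙 (r ≟ c) * (𝟙 (a ℕ.+ b ℕ.+ c ≟ n) * h a))
        ≡⟨ sumBelow-cong (suc n) (λ a → sumBelow-cong (suc n) λ b →
             sumBelow-pick (suc n) r (λ c → 𝟙 (a ℕ.+ b ℕ.+ c ≟ n) * h a) (s≤s r≤n)) ⟩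
      sumBelow (suc n) (λ a → sumBelow (suc n) λ b → 𝟙 (a ℕ.+ b ℕ.+ r ≟ n) * h a)
        ≡⟨ sumBelow-cong (suc n) (λ a → sumBelow-cong (suc n) λ b →
             cong (λ s → 𝟙 (s ≟ n) * h a) (m+n+o≡m+o+n a b r)) ⟩
      sumBelow (suc n) (λ a → sumBelow (suc n) λ b → 𝟙 (a ℕ.+ r ℕ.+ b ≟ n) * h a)
        ≡⟨ sumBelow-cong (suc n) (λ a → sumBelow-pick-∸ n (a ℕ.+ r) (λ _ → h a)) ⟩
      sumBelow (suc n) (λ a → 𝟙 (a ℕ.+ r ≤? n) * h a)
        ≡⟨ sumBelow-truncate n r h r≤n ⟩
      sumBelow (suc (n ∸ r)) h  ∎

  -- Neighbour sums

  -- Phrased with ¬? to match the filter in diffCount.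
  mismatch : {P : Set} → Dec P → ℕ
  mismatch P? = if does (¬? P?) then 1 else 0

  mismatches : (p q r a b c : ℕ) → ℕ
  mismatches p q r a b c = mismatch (p ≟ a) ℕ.+ (mismatch (q ≟ b) ℕ.+ mismatch (r ≟ c))

  length-filter-∷ : {A : Set} {P : A → Set} (P? : ∀ x → Dec (P x)) (x : A) (xs : List A) →
    length (filter P? (x ∷ xs)) ≡ (if does (P? x) then 1 else 0) ℕ.+ length (filter P? xs)
  length-filter-∷ P? x xs with does (P? x)
  ... | true  = refl
  ... | false = refl

  diffCount-mismatches : ∀ (t s : Triple) → diffCount t s ≡ mismatches (t 0F) (t 1F) (t 2F) (s 0F) (s 1F) (s 2F)
  diffCount-mismatches t s =
    trans (length-filter-∷ differs 0F _) (cong (mismatch (t 0F ≟ s 0F) ℕ.+_)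
    (trans (length-filter-∷ differs 1F _) (cong (mismatch (t 1F ≟ s 1F) ℕ.+_)
    (trans (length-filter-∷ differs 2F _) (ℕₚ.+-identityʳ _)))))
    where differs = λ c → ¬? (t c ≟ s c)

  -- On the simplex, agreement in two coordinates forces agreement in the third.
  neighbour-indicator : ∀ {n p q r a b c} → p ℕ.+ q ℕ.+ r ≡ n → a ℕ.+ b ℕ.+ c ≡ n →
    (A? : Dec (p ≡ a)) (B? : Dec (q ≡ b)) (C? : Dec (r ≡ c)) →
    𝟙 (mismatch A? ℕ.+ (mismatch B? ℕ.+ mismatch C?) ≟ 2) ≡ 𝟙 A? + 𝟙 B? + 𝟙 C? - 3ℚ * (𝟙 A? * 𝟙 B?)
  neighbour-indicator _ _ (yes refl) (yes refl) (yes refl) = refl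
  neighbour-indicator {p = p} {q} {r} {c = c} x∈ y∈ (yes refl) (yes refl) (no r≢c) =
    ⊥-elim (r≢c (ℕₚ.+-cancelˡ-≡ (p ℕ.+ q) r c (trans x∈ (sym y∈))))
  neighbour-indicator {p = p} {q} {r} {b = b} x∈ y∈ (yes refl) (no q≢b) (yes refl) =
    ⊥-elim (q≢b (ℕₚ.+-cancelˡ-≡ p q b (ℕₚ.+-cancelʳ-≡ r (p ℕ.+ q) (p ℕ.+ b) (trans x∈ (sym y∈)))))
  neighbour-indicator {p = p} {q} {r} {a = a} x∈ y∈ (no p≢a) (yes refl) (yes refl) =
    ⊥-elim (p≢a (ℕₚ.+-cancelʳ-≡ q p a (ℕₚ.+-cancelʳ-≡ r (p ℕ.+ q) (a ℕ.+ q) (trans x∈ (sym y∈)))))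
  neighbour-indicator _ _ (yes _) (no _)  (no _)  = refl
  neighbour-indicator _ _ (no _)  (yes _) (no _)  = refl
  neighbour-indicator _ _ (no _)  (no _)  (yes _) = refl
  neighbour-indicator _ _ (no _)  (no _)  (no _)  = refl

  onNeighbours : (p q r : ℕ) → (ℕ → ℕ → ℕ → ℚ) → ℕ → ℕ → ℕ → ℚ
  onNeighbours p q r G a b c = 𝟙 (mismatches p q r a b c ≟ 2) * G a b c

  neighbourSum : (n p q r : ℕ) → (ℕ → ℕ → ℕ → ℚ) → ℚ
  neighbourSum n p q r G = simplexSum n (onNeighbours p q r G)

  module _ {n : ℕ} where

    neighbourSum-- : ∀ p q r (G G′ : ℕ → ℕ → ℕ → ℚ) →
      neighbourSum n p q r (λ a b c → G a b c - G′ a b c) ≡ neighbourSum n p q r G - neighbourSum n p q r G′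
    neighbourSum-- p q r G G′ =
      trans (simplexSum-cong {n} λ a b c _ → *-distribˡ-- (𝟙 (mismatches p q r a b c ≟ 2)) (G a b c) (G′ a b c))
            (simplexSum-- {n} (onNeighbours p q r G) (onNeighbours p q r G′))

    neighbourSum-swap : ∀ p q r (G : ℕ → ℕ → ℕ → ℚ) →
      neighbourSum n p q r (λ a b c → G b a c) ≡ neighbourSum n q p r G
    neighbourSum-swap p q r G = trans (simplexSum-swap {n} (onNeighbours p q r (λ a b c → G b a c)))
      (simplexSum-cong {n} λ a b c _ → cong (λ m → 𝟙 (m ≟ 2) * G a b c)
        (m+[n+o]≡n+[m+o] (mismatch (p ≟ b)) (mismatch (q ≟ a)) (mismatch (r ≟ c))))

    neighbourSum-firstCoordinate : ∀ {p q r} → p ℕ.+ q ℕ.+ r ≡ n → (h : ℕ → ℚ) →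
      neighbourSum n p q r (λ a _ _ → h a)
        ≡ h p * (fromℕ (n ∸ p) - 2ℚ) + (sumBelow (suc (n ∸ q)) h + sumBelow (suc (n ∸ r)) h)
    neighbourSum-firstCoordinate {p} {q} {r} x∈ h = begin
      neighbourSum n p q r (λ a _ _ → h a)
        ≡⟨ simplexSum-cong (λ a b c y∈ →
             trans (cong (_* h a) (neighbour-indicator x∈ y∈ (p ≟ a) (q ≟ b) (r ≟ c)))
                   (expand (𝟙 (p ≟ a)) (𝟙 (q ≟ b)) (𝟙 (r ≟ c)) (h a))) ⟩
      simplexSum n (λ a b c → (X₁ a b c + X₂ a b c + X₃ a b c) - 3ℚ * X₄ a b c)
        ≡⟨ simplexSum-- {n} (λ a b c → X₁ a b c + X₂ a b c + X₃ a b c) (λ a b c → 3ℚ * X₄ a b c) ⟩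
      simplexSum n (λ a b c → X₁ a b c + X₂ a b c + X₃ a b c) - simplexSum n (λ a b c → 3ℚ * X₄ a b c)
        ≡⟨ cong₂ _-_ (trans (simplexSum-+ {n} (λ a b c → X₁ a b c + X₂ a b c) X₃)
                            (cong (_+ simplexSum n X₃) (simplexSum-+ {n} X₁ X₂)))
                     (simplexSum-*ˡ {n} 3ℚ X₄) ⟩
      (simplexSum n X₁ + simplexSum n X₂ + simplexSum n X₃) - 3ℚ * simplexSum n X₄
        ≡⟨ cong₂ _-_ (cong₂ _+_ (cong₂ _+_ (simplexSum-firstFixed h p≤n) (simplexSum-secondFixed h q≤n))
                                (simplexSum-thirdFixed h r≤n))
                     (cong (3ℚ *_) (simplexSum-point h p+q≤n)) ⟩
      (fromℕ (suc (n ∸ p)) * h p + H q + H r) - 3ℚ * h p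
        ≡⟨ cong (λ s → (s * h p + H q + H r) - 3ℚ * h p) (fromℕ-suc (n ∸ p)) ⟩
      ((1ℚ + fromℕ (n ∸ p)) * h p + H q + H r) - 3ℚ * h p
        ≡⟨ regroup (fromℕ (n ∸ p)) (h p) (H q) (H r) ⟩
      h p * (fromℕ (n ∸ p) - 2ℚ) + (H q + H r) ∎
      where
      X₁ X₂ X₃ X₄ : ℕ → ℕ → ℕ → ℚ
      X₁ a b c = 𝟙 (p ≟ a) * h a
      X₂ a b c = 𝟙 (q ≟ b) * h a
      X₃ a b c = 𝟙 (r ≟ c) * h a
      X₄ a b c = 𝟙 (p ≟ a) * (𝟙 (q ≟ b) * h a)
      H : ℕ → ℚ
      H m = sumBelow (suc (n ∸ m)) h
      p+q≤n : p ℕ.+ q ≤ n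
      p+q≤n = subst (p ℕ.+ q ≤_) x∈ (ℕₚ.m≤m+n (p ℕ.+ q) r)
      p≤n = ℕₚ.m+n≤o⇒m≤o p p+q≤n
      q≤n = ℕₚ.m+n≤o⇒n≤o p p+q≤n
      r≤n = ℕₚ.m+n≤o⇒n≤o (p ℕ.+ q) (ℕₚ.≤-reflexive x∈)
      expand : ∀ A B C x → (A + B + C - 3ℚ * (A * B)) * x ≡ (A * x + B * x + C * x) - 3ℚ * (A * (B * x))
      expand = solve-∀ ℚ-ring
      regroup : ∀ N x y z → ((1ℚ + N) * x + y + z) - 3ℚ * x ≡ x * (N - 2ℚ) + (y + z)
      regroup = solve-∀ ℚ-ring

  -- The adjacency operator as a neighbour sum

  sumℚ-++ : (xs ys : List ℚ) → sumℚ (xs ++ ys) ≡ sumℚ xs + sumℚ ys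
  sumℚ-++ []       ys = sym (ℚₚ.+-identityˡ _)
  sumℚ-++ (x ∷ xs) ys = trans (cong (x +_) (sumℚ-++ xs ys)) (sym (ℚₚ.+-assoc x _ _))

  module _ {A : Set} where

    sumℚ-cong : ∀ {f g : A → ℚ} (xs : List A) → (∀ x → f x ≡ g x) → sumℚ (List.map f xs) ≡ sumℚ (List.map g xs)
    sumℚ-cong xs f≗g = cong sumℚ (List.map-cong f≗g xs)

    sumℚ-filter : ∀ {P : A → Set} (P? : ∀ x → Dec (P x)) (f : A → ℚ) xs →
      sumℚ (List.map f (filter P? xs)) ≡ sumℚ (List.map (λ x → 𝟙 (P? x) * f x) xs)
    sumℚ-filter P? f []       = refl
    sumℚ-filter P? f (x ∷ xs) with does (P? x)
    ... | true  = cong₂ _+_ (sym (ℚₚ.*-identityˡ (f x))) (sumℚ-filter P? f xs)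
    ... | false = trans (sumℚ-filter P? f xs) (sym (trans (cong (_+ _) (ℚₚ.*-zeroˡ (f x))) (ℚₚ.+-identityˡ _)))

    sumℚ-applyUpTo : ∀ (H : A → ℚ) (g : ℕ → A) N → sumℚ (List.map H (applyUpTo g N)) ≡ sumBelow N (H ∘ g)
    sumℚ-applyUpTo H g zero    = refl
    sumℚ-applyUpTo H g (suc N) = cong (H (g 0) +_) (sumℚ-applyUpTo H (g ∘ suc) N)

    module _ {B : Set} where

      sumℚ-concatMap : ∀ (f : B → ℚ) (K : A → List B) xs →
        sumℚ (List.map f (concatMap K xs)) ≡ sumℚ (List.map (λ x → sumℚ (List.map f (K x))) xs)
      sumℚ-concatMap f K []       = refl
      sumℚ-concatMap f K (x ∷ xs) = begin
        sumℚ (List.map f (K x ++ concatMap K xs))                  ≡⟨ cong sumℚ (List.map-++ f (K x) (concatMap K xs)) ⟩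
        sumℚ (List.map f (K x) ++ List.map f (concatMap K xs))     ≡⟨ sumℚ-++ (List.map f (K x)) _ ⟩
        sumℚ (List.map f (K x)) + sumℚ (List.map f (concatMap K xs)) ≡⟨ cong (sumℚ (List.map f (K x)) +_) (sumℚ-concatMap f K xs) ⟩
        sumℚ (List.map f (K x)) + sumℚ (List.map (λ x → sumℚ (List.map f (K x))) xs) ∎

      sumℚ-mapMaybe : ∀ (f : B → ℚ) (g : A → Maybe B) xs →
        sumℚ (List.map f (mapMaybe g xs)) ≡ sumℚ (List.map (maybe′ f 0ℚ ∘ g) xs)
      sumℚ-mapMaybe f g []       = refl
      sumℚ-mapMaybe f g (x ∷ xs) with g x
      ... | nothing = trans (sumℚ-mapMaybe f g xs) (sym (ℚₚ.+-identityˡ _))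
      ... | just y  = cong (f y +_) (sumℚ-mapMaybe f g xs)

  sumℚ-triples : ∀ N (H : Triple → ℚ) →
    sumℚ (List.map H (concatMap (λ a → concatMap (λ b → List.map (mkTriple a b) (List.upTo N)) (List.upTo N)) (List.upTo N)))
      ≡ sumCube N (λ a b c → H (mkTriple a b c))
  sumℚ-triples N H =
    trans (sumℚ-concatMap H _ (List.upTo N)) (trans (sumℚ-applyUpTo _ (λ a → a) N) (sumBelow-cong N λ a →
    trans (sumℚ-concatMap H _ (List.upTo N)) (trans (sumℚ-applyUpTo _ (λ b → b) N) (sumBelow-cong N λ b →
    trans (cong sumℚ (sym (List.map-∘ (List.upTo N)))) (sumℚ-applyUpTo (H ∘ mkTriple a b) (λ c → c) N)))))

  maybe-checkVertex : ∀ n (F : Vertex n → ℚ) (t : Triple) x → (∀ t∈ → F (t , t∈) ≡ x) →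
    maybe′ F 0ℚ (checkVertex n t) ≡ 𝟙 (t 0F ℕ.+ t 1F ℕ.+ t 2F ≟ n) * x
  maybe-checkVertex n F t x F≡x with t 0F ℕ.+ t 1F ℕ.+ t 2F ≟ n
  ... | yes t∈ = trans (F≡x t∈) (sym (trans (cong (_* x) (𝟙-yes (t 0F ℕ.+ t 1F ℕ.+ t 2F ≟ n) t∈)) (ℚₚ.*-identityˡ x)))
  ... | no  t∉ = sym (trans (cong (_* x) (𝟙-no (t 0F ℕ.+ t 1F ℕ.+ t 2F ≟ n) t∉)) (ℚₚ.*-zeroˡ x))

  sumℚ-vertices : ∀ n (F : Vertex n → ℚ) (G : ℕ → ℕ → ℕ → ℚ) →
    (∀ y → F y ≡ G (proj₁ y 0F) (proj₁ y 1F) (proj₁ y 2F)) → sumℚ (List.map F (vertices n)) ≡ simplexSum n G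
  sumℚ-vertices n F G F≡G = begin
    sumℚ (List.map F (vertices n))
      ≡⟨ sumℚ-mapMaybe F (checkVertex n) triples ⟩
    sumℚ (List.map (maybe′ F 0ℚ ∘ checkVertex n) triples)
      ≡⟨ sumℚ-cong triples (λ t → maybe-checkVertex n F t _ (λ t∈ → F≡G (t , t∈))) ⟩
    sumℚ (List.map G′ triples)
      ≡⟨ sumℚ-triples (suc n) G′ ⟩
    simplexSum n G  ∎
    where
    G′ : Triple → ℚ
    G′ t = onSimplex n G (t 0F) (t 1F) (t 2F)
    upTo = List.upTo (suc n)
    triples = concatMap (λ a → concatMap (λ b → List.map (mkTriple a b) upTo) upTo) upTo

  adjOp-neighbourSum : ∀ n (f : Vec n) (G : ℕ → ℕ → ℕ → ℚ) → (∀ y → f y ≡ G (proj₁ y 0F) (proj₁ y 1F) (proj₁ y 2F)) →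
    ∀ x → adjOp n f x ≡ neighbourSum n (proj₁ x 0F) (proj₁ x 1F) (proj₁ x 2F) G
  adjOp-neighbourSum n f G f≡G (x , _) =
    trans (sumℚ-filter (λ y → diffCount x (proj₁ y) ≟ 2) f (vertices n))
          (sumℚ-vertices n (λ y → 𝟙 (diffCount x (proj₁ y) ≟ 2) * f y) (onNeighbours (x 0F) (x 1F) (x 2F) G)
            λ (y , y∈) → cong₂ (λ m v → 𝟙 (m ≟ 2) * v) (diffCount-mismatches x y) (f≡G (y , y∈)))

  -- R is an eigenvector

  indic-𝟙 : ∀ a i → indic a i ≡ 𝟙 (i ≟ a)
  indic-𝟙 a i with a ≟ i
  ... | yes refl = sym (𝟙-yes (a ≟ a) refl)
  ... | no  a≢i  = sym (𝟙-no (i ≟ a) (a≢i ∘ sym))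

  Rvec-dipole : ∀ n k (y : Vertex n) → Rvec n k y ≡ dipole k (proj₁ y 0F) - dipole k (proj₁ y 1F)
  Rvec-dipole n k (y , _) = trans
    (cong₂ _+_ (cong₂ _-_ (cong₂ _-_ (indic-𝟙 (y 0F) k) (indic-𝟙 (y 1F) k)) (indic-𝟙 (y 0F) (suc k))) (indic-𝟙 (y 1F) (suc k)))
    (regroup (𝟙 (k ≟ y 0F)) (𝟙 (k ≟ y 1F)) (𝟙 (suc k ≟ y 0F)) (𝟙 (suc k ≟ y 1F)))
    where
    regroup : ∀ x₀ y₀ x₁ y₁ → ((x₀ - y₀) - x₁) + y₁ ≡ (x₀ - x₁) - (y₀ - y₁)
    regroup = solve-∀ ℚ-ring

  dipoleResponse : ℕ → ℕ → ℕ → ℚ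
  dipoleResponse n k t = dipole k t * (fromℕ (n ∸ t) - 2ℚ) - 𝟙 (k ≟ n ∸ t)

  adjOp-Rvec : ∀ n k (x : Vertex n) → adjOp n (Rvec n k) x ≡ dipoleResponse n k (proj₁ x 0F) - dipoleResponse n k (proj₁ x 1F)
  adjOp-Rvec n k (x , x∈) = begin
    adjOp n (Rvec n k) (x , x∈)
      ≡⟨ adjOp-neighbourSum n (Rvec n k) (λ a b _ → dipole k a - dipole k b) (Rvec-dipole n k) (x , x∈) ⟩
    neighbourSum n p q r (λ a b _ → dipole k a - dipole k b)
      ≡⟨ neighbourSum-- {n} p q r (λ a _ _ → dipole k a) (λ _ b _ → dipole k b) ⟩
    neighbourSum n p q r (λ a _ _ → dipole k a) - neighbourSum n p q r (λ _ b _ → dipole k b)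
      ≡⟨ cong (λ v → neighbourSum n p q r (λ a _ _ → dipole k a) - v) (neighbourSum-swap {n} p q r (λ a _ _ → dipole k a)) ⟩
    neighbourSum n p q r (λ a _ _ → dipole k a) - neighbourSum n q p r (λ a _ _ → dipole k a)
      ≡⟨ cong₂ _-_ (neighbourSum-firstCoordinate x∈ (dipole k)) (neighbourSum-firstCoordinate x∈′ (dipole k)) ⟩
    (A p + (D q + D r)) - (A q + (D p + D r))
      ≡⟨ cong₂ (λ u v → (A p + u) - (A q + v)) (cong₂ _+_ (sumBelow-dipole k (n ∸ q)) (sumBelow-dipole k (n ∸ r)))
                                                 (cong₂ _+_ (sumBelow-dipole k (n ∸ p)) (sumBelow-dipole k (n ∸ r))) ⟩
    (A p + (E q + E r)) - (A q + (E p + E r))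
      ≡⟨ regroup (A p) (A q) (E q) (E r) (E p) ⟩
    dipoleResponse n k p - dipoleResponse n k q ∎
    where
    p = x 0F
    q = x 1F
    r = x 2F
    x∈′ : q ℕ.+ p ℕ.+ r ≡ n
    x∈′ = trans (cong (ℕ._+ r) (ℕₚ.+-comm q p)) x∈
    A D E : ℕ → ℚ
    A t = dipole k t * (fromℕ (n ∸ t) - 2ℚ)
    D m = sumBelow (suc (n ∸ m)) (dipole k)
    E m = 𝟙 (k ≟ n ∸ m)
    regroup : ∀ a b u w v → (a + (u + w)) - (b + (v + w)) ≡ (a - v) - (b - u)
    regroup = solve-∀ ℚ-ring

  Rvec-eigenvector : ∀ n k μ → (∀ t → t ≤ n → dipoleResponse n k t ≡ μ * dipole k t) → IsEigenvector n (Rvec n k) μ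
  Rvec-eigenvector n k μ response x@(y , y∈) = begin
    adjOp n (Rvec n k) x                                      ≡⟨ adjOp-Rvec n k x ⟩
    dipoleResponse n k (y 0F) - dipoleResponse n k (y 1F)     ≡⟨ cong₂ _-_ (response (y 0F) y₀≤n) (response (y 1F) y₁≤n) ⟩
    μ * dipole k (y 0F) - μ * dipole k (y 1F)                 ≡⟨ *-distribˡ-- μ _ _ ⟨
    μ * (dipole k (y 0F) - dipole k (y 1F))                   ≡⟨ cong (μ *_) (Rvec-dipole n k x) ⟨
    μ * Rvec n k x                                            ∎
    where
    y₀+y₁≤n = subst (y 0F ℕ.+ y 1F ≤_) y∈ (ℕₚ.m≤m+n _ (y 2F))
    y₀≤n = ℕₚ.m+n≤o⇒m≤o (y 0F) y₀+y₁≤n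
    y₁≤n = ℕₚ.m+n≤o⇒n≤o (y 0F) y₀+y₁≤n

  𝟙-∸-flip : ∀ {n k t} → k ≤ n → t ≤ n → 𝟙 (k ≟ n ∸ t) ≡ 𝟙 (n ∸ k ≟ t)
  𝟙-∸-flip {n} {k} {t} k≤n t≤n = 𝟙-cong (k ≟ n ∸ t) (n ∸ k ≟ t)
    (λ k≡n∸t → trans (cong (n ∸_) k≡n∸t) (ℕₚ.m∸[m∸n]≡n t≤n))
    (λ n∸k≡t → trans (sym (ℕₚ.m∸[m∸n]≡n k≤n)) (cong (n ∸_) n∸k≡t))

  dipoleResponse-expand : ∀ {n k t} → k ≤ n → t ≤ n → dipoleResponse n k t ≡
    (𝟙 (k ≟ t) * (fromℕ n - fromℕ k - 2ℚ) - 𝟙 (suc k ≟ t) * (fromℕ n - fromℕ (suc k) - 2ℚ)) - 𝟙 (n ∸ k ≟ t)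
  dipoleResponse-expand {n} {k} {t} k≤n t≤n = begin
    dipole k t * (fromℕ (n ∸ t) - 2ℚ) - 𝟙 (k ≟ n ∸ t)
      ≡⟨ cong₂ (λ m e → dipole k t * (m - 2ℚ) - e) (fromℕ-∸ t≤n) (𝟙-∸-flip k≤n t≤n) ⟩
    (𝟙 (k ≟ t) - 𝟙 (suc k ≟ t)) * (fromℕ n - fromℕ t - 2ℚ) - 𝟙 (n ∸ k ≟ t)
      ≡⟨ cong (_- 𝟙 (n ∸ k ≟ t)) (*-distribʳ-- (𝟙 (k ≟ t)) (𝟙 (suc k ≟ t)) (fromℕ n - fromℕ t - 2ℚ)) ⟩
    (𝟙 (k ≟ t) * (fromℕ n - fromℕ t - 2ℚ) - 𝟙 (suc k ≟ t) * (fromℕ n - fromℕ t - 2ℚ)) - 𝟙 (n ∸ k ≟ t)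
      ≡⟨ cong₂ (λ u v → (u - v) - 𝟙 (n ∸ k ≟ t)) (at k) (at (suc k)) ⟩
    (𝟙 (k ≟ t) * (fromℕ n - fromℕ k - 2ℚ) - 𝟙 (suc k ≟ t) * (fromℕ n - fromℕ (suc k) - 2ℚ)) - 𝟙 (n ∸ k ≟ t) ∎
    where
    at : ∀ m → 𝟙 (m ≟ t) * (fromℕ n - fromℕ t - 2ℚ) ≡ 𝟙 (m ≟ t) * (fromℕ n - fromℕ m - 2ℚ)
    at m = 𝟙-*-cong (m ≟ t) λ m≡t → cong (λ s → fromℕ n - fromℕ s - 2ℚ) (sym m≡t)
    *-distribʳ-- : ∀ x y z → (x - y) * z ≡ x * z - y * z
    *-distribʳ-- = solve-∀ ℚ-ring

  dipoleResponse-even : ∀ {n k t} → k ≤ n → n ∸ k ≡ k → t ≤ n →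
    dipoleResponse n k t ≡ (fromℕ n - fromℕ k - 3ℚ) * dipole k t
  dipoleResponse-even {n} {k} {t} k≤n n∸k≡k t≤n = begin
    dipoleResponse n k t
      ≡⟨ dipoleResponse-expand k≤n t≤n ⟩
    (𝟙 (k ≟ t) * (fromℕ n - fromℕ k - 2ℚ) - 𝟙 (suc k ≟ t) * (fromℕ n - fromℕ (suc k) - 2ℚ)) - 𝟙 (n ∸ k ≟ t)
      ≡⟨ cong₂ (λ s e → (𝟙 (k ≟ t) * (fromℕ n - fromℕ k - 2ℚ) - 𝟙 (suc k ≟ t) * (fromℕ n - s - 2ℚ)) - 𝟙 (e ≟ t))
               (fromℕ-suc k) n∸k≡k ⟩
    (𝟙 (k ≟ t) * (fromℕ n - fromℕ k - 2ℚ) - 𝟙 (suc k ≟ t) * (fromℕ n - (1ℚ + fromℕ k) - 2ℚ)) - 𝟙 (k ≟ t)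
      ≡⟨ regroup (fromℕ n) (fromℕ k) (𝟙 (k ≟ t)) (𝟙 (suc k ≟ t)) ⟩
    (fromℕ n - fromℕ k - 3ℚ) * dipole k t ∎
    where
    regroup : ∀ N K A B → (A * (N - K - 2ℚ) - B * (N - (1ℚ + K) - 2ℚ)) - A ≡ (N - K - 3ℚ) * (A - B)
    regroup = solve-∀ ℚ-ring

  dipoleResponse-odd : ∀ {n k t} → k ≤ n → n ∸ k ≡ suc k → t ≤ n →
    dipoleResponse n k t ≡ (fromℕ n - fromℕ k - 2ℚ) * dipole k t
  dipoleResponse-odd {n} {k} {t} k≤n n∸k≡1+k t≤n = begin
    dipoleResponse n k t
      ≡⟨ dipoleResponse-expand k≤n t≤n ⟩
    (𝟙 (k ≟ t) * (fromℕ n - fromℕ k - 2ℚ) - 𝟙 (suc k ≟ t) * (fromℕ n - fromℕ (suc k) - 2ℚ)) - 𝟙 (n ∸ k ≟ t)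
      ≡⟨ cong₂ (λ s e → (𝟙 (k ≟ t) * (fromℕ n - fromℕ k - 2ℚ) - 𝟙 (suc k ≟ t) * (fromℕ n - s - 2ℚ)) - 𝟙 (e ≟ t))
               (fromℕ-suc k) n∸k≡1+k ⟩
    (𝟙 (k ≟ t) * (fromℕ n - fromℕ k - 2ℚ) - 𝟙 (suc k ≟ t) * (fromℕ n - (1ℚ + fromℕ k) - 2ℚ)) - 𝟙 (suc k ≟ t)
      ≡⟨ regroup (fromℕ n) (fromℕ k) (𝟙 (k ≟ t)) (𝟙 (suc k ≟ t)) ⟩
    (fromℕ n - fromℕ k - 2ℚ) * dipole k t ∎
    where
    regroup : ∀ N K A B → (A * (N - K - 2ℚ) - B * (N - (1ℚ + K) - 2ℚ)) - B ≡ (N - K - 2ℚ) * (A - B)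
    regroup = solve-∀ ℚ-ring

  ∸-half-even : ∀ {n k} → n ≡ k ℕ.+ k → n ∸ k ≡ k
  ∸-half-even {k = k} n≡2k = trans (cong (_∸ k) n≡2k) (ℕₚ.m+n∸m≡n k k)

  ∸-half-odd : ∀ {n k} → n ≡ suc (k ℕ.+ k) → n ∸ k ≡ suc k
  ∸-half-odd {k = k} n≡2k+1 = trans (cong (_∸ k) (trans n≡2k+1 (sym (ℕₚ.+-suc k k)))) (ℕₚ.m+n∸m≡n k (suc k))

  Rvec-eigenvector-even : ∀ n k → n ≡ k ℕ.+ k → IsEigenvector n (Rvec n k) (fromℤ (ℤ.+ n ℤ.- ℤ.+ k ℤ.- ℤ.+ 3))
  Rvec-eigenvector-even n k n≡2k = subst (IsEigenvector n (Rvec n k)) (sym (fromℤ-[m-n-c] n k 3))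
    (Rvec-eigenvector n k (fromℕ n - fromℕ k - 3ℚ) λ t → dipoleResponse-even k≤n (∸-half-even n≡2k))
    where
    k≤n = subst (k ≤_) (sym n≡2k) (ℕₚ.m≤m+n k k)

  Rvec-eigenvector-odd : ∀ n k → n ≡ suc (k ℕ.+ k) → IsEigenvector n (Rvec n k) (fromℤ (ℤ.+ n ℤ.- ℤ.+ k ℤ.- ℤ.+ 2))
  Rvec-eigenvector-odd n k n≡2k+1 = subst (IsEigenvector n (Rvec n k)) (sym (fromℤ-[m-n-c] n k 2))
    (Rvec-eigenvector n k (fromℕ n - fromℕ k - 2ℚ) λ t → dipoleResponse-odd k≤n (∸-half-odd n≡2k+1))
    where
    k≤n = subst (k ≤_) (sym n≡2k+1) (ℕₚ.m≤n⇒m≤1+n (ℕₚ.m≤m+n k k))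

  halve : ∀ n → n ≡ n % 2 ℕ.+ (n / 2 ℕ.+ n / 2)
  halve n = trans (m≡m%n+[m/n]*n n 2)
    (cong (n % 2 ℕ.+_) (trans (ℕₚ.*-comm (n / 2) 2) (cong (n / 2 ℕ.+_) (ℕₚ.+-identityʳ (n / 2)))))

  half-even : ∀ n → n % 2 ≡ 0 → n ≡ n / 2 ℕ.+ n / 2
  half-even n n%2≡0 = trans (halve n) (cong (ℕ._+ (n / 2 ℕ.+ n / 2)) n%2≡0)

  half-odd : ∀ n → n % 2 ≡ 1 → n ≡ suc (n / 2 ℕ.+ n / 2)
  half-odd n n%2≡1 = trans (halve n) (cong (ℕ._+ (n / 2 ℕ.+ n / 2)) n%2≡1)

  half-parity : ∀ n → n ≡ n / 2 ℕ.+ n / 2 ⊎ n ≡ suc (n / 2 ℕ.+ n / 2)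
  half-parity n with n % 2 | m%n<n n 2 | half-even n | half-odd n
  ... | 0           | _            | even | _   = inj₁ (even refl)
  ... | 1           | _            | _    | odd = inj₂ (odd refl)
  ... | suc (suc _) | s≤s (s≤s ()) | _    | _

  -- The span of the orbit

  pair : ∀ {n} → Vec n → Vec n → Fin 2 → Vec n
  pair f g 0F      = f
  pair f g (sF 0F) = g

  swap₁₂ : Permutation′ 3
  swap₁₂ = transpose 1F 2F

  orbitBasis : ∀ n k → Fin 2 → Vec n
  orbitBasis n k = pair (Rvec n k) (actVec swap₁₂ (Rvec n k))

  actVec-Rvec : ∀ n k τ (y : Vertex n) →
    actVec τ (Rvec n k) y ≡ dipole k (proj₁ y (τ ⟨$⟩ʳ 0F)) - dipole k (proj₁ y (τ ⟨$⟩ʳ 1F))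
  actVec-Rvec n k τ y = Rvec-dipole n k (invAct τ y)

  basis-in-orbitSpan : ∀ n k j → InSpan {n} {Permutation′ 3} (λ τ → actVec τ (Rvec n k)) (orbitBasis n k j)
  basis-in-orbitSpan n k 0F      = ((Permutation.id , 1ℚ) ∷ []) , λ x → sym (trans (ℚₚ.+-identityʳ _) (ℚₚ.*-identityˡ _))
  basis-in-orbitSpan n k (sF 0F) = ((swap₁₂ , 1ℚ) ∷ []) , λ x → sym (trans (ℚₚ.+-identityʳ _) (ℚₚ.*-identityˡ _))

  basisCoefficients : Fin 3 → ℚ × ℚ
  basisCoefficients 0F           = 0ℚ , 0ℚ
  basisCoefficients (sF 0F)      = 1ℚ , 0ℚ
  basisCoefficients (sF (sF 0F)) = 0ℚ , 1ℚ

  basisCoefficients-spec : ∀ i (G : Fin 3 → ℚ) →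
    G 0F - G i ≡ proj₁ (basisCoefficients i) * (G 0F - G 1F) + proj₂ (basisCoefficients i) * (G 0F - G 2F)
  basisCoefficients-spec 0F           G = spec (G 0F) (G 1F) (G 2F)
    where
    spec : ∀ x y z → x - x ≡ 0ℚ * (x - y) + 0ℚ * (x - z)
    spec = solve-∀ ℚ-ring
  basisCoefficients-spec (sF 0F)      G = spec (G 0F) (G 1F) (G 2F)
    where
    spec : ∀ x y z → x - y ≡ 1ℚ * (x - y) + 0ℚ * (x - z)
    spec = solve-∀ ℚ-ring
  basisCoefficients-spec (sF (sF 0F)) G = spec (G 0F) (G 1F) (G 2F)
    where
    spec : ∀ x y z → x - z ≡ 0ℚ * (x - y) + 1ℚ * (x - z)
    spec = solve-∀ ℚ-ring

  orbit-in-basisSpan : ∀ n k τ → InSpan (orbitBasis n k) (actVec τ (Rvec n k))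
  orbit-in-basisSpan n k τ = ((0F , a₁ j - a₁ i) ∷ (sF 0F , a₂ j - a₂ i) ∷ []) , λ x → begin
    actVec τ (Rvec n k) x
      ≡⟨ actVec-Rvec n k τ x ⟩
    G x i - G x j
      ≡⟨ difference (G x 0F) (G x i) (G x j) ⟩
    (G x 0F - G x j) - (G x 0F - G x i)
      ≡⟨ cong₂ _-_ (basisCoefficients-spec j (G x)) (basisCoefficients-spec i (G x)) ⟩
    (a₁ j * B₁ x + a₂ j * B₂ x) - (a₁ i * B₁ x + a₂ i * B₂ x)
      ≡⟨ regroup (a₁ i) (a₂ i) (a₁ j) (a₂ j) (B₁ x) (B₂ x) ⟩
    (a₁ j - a₁ i) * B₁ x + ((a₂ j - a₂ i) * B₂ x + 0ℚ)
      ≡⟨ cong₂ (λ u v → (a₁ j - a₁ i) * u + ((a₂ j - a₂ i) * v + 0ℚ)) (Rvec-dipole n k x) (actVec-Rvec n k swap₁₂ x) ⟨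
    (a₁ j - a₁ i) * Rvec n k x + ((a₂ j - a₂ i) * actVec swap₁₂ (Rvec n k) x + 0ℚ)  ∎
    where
    i = τ ⟨$⟩ʳ 0F
    j = τ ⟨$⟩ʳ 1F
    a₁ a₂ : Fin 3 → ℚ
    a₁ = proj₁ ∘ basisCoefficients
    a₂ = proj₂ ∘ basisCoefficients
    G : Vertex n → Fin 3 → ℚ
    G x c = dipole k (proj₁ x c)
    B₁ B₂ : Vertex n → ℚ
    B₁ x = G x 0F - G x 1F
    B₂ x = G x 0F - G x 2F
    difference : ∀ g₀ gᵢ gⱼ → gᵢ - gⱼ ≡ (g₀ - gⱼ) - (g₀ - gᵢ)
    difference = solve-∀ ℚ-ring
    regroup : ∀ a b c d u v → (c * u + d * v) - (a * u + b * v) ≡ (c - a) * u + ((d - b) * v + 0ℚ)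
    regroup = solve-∀ ℚ-ring

  minor : ∀ {n} → Vec n → Vec n → Vertex n → Vertex n → ℚ
  minor f g y y′ = f y * g y′ - g y * f y′

  NonsingularMinor : ∀ {n} → Vec n → Vec n → Set
  NonsingularMinor {n} f g = Σ (Vertex n × Vertex n) λ (y , y′) → minor f g y y′ ≢ 0ℚ

  *-cancelʳ-≢0 : ∀ {x d} → d ≢ 0ℚ → x * d ≡ 0ℚ → x ≡ 0ℚ
  *-cancelʳ-≢0 {x} {d} d≢0 x*d≡0 = begin
    x                  ≡⟨ ℚₚ.*-identityʳ x ⟨
    x * 1ℚ             ≡⟨ cong (x *_) (ℚₚ.*-inverseʳ d) ⟨
    x * (d * ℚ.1/ d)   ≡⟨ ℚₚ.*-assoc x d (ℚ.1/ d) ⟨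
    (x * d) * ℚ.1/ d   ≡⟨ cong (_* ℚ.1/ d) x*d≡0 ⟩
    0ℚ * ℚ.1/ d        ≡⟨ ℚₚ.*-zeroˡ (ℚ.1/ d) ⟩
    0ℚ                 ∎
    where
    instance _ = ℚ.≢-nonZero d≢0

  module _ {n} (f g : Vec n) where

    nonsingularMinor⇒linIndep : NonsingularMinor f g → LinIndep (pair f g)
    nonsingularMinor⇒linIndep ((y , y′) , D≢0) c vanishes = λ where
        0F      → *-cancelʳ-≢0 D≢0 (trans (cramer₀ c₀ c₁ (f y) (g y) (f y′) (g y′)) (eliminate (g y′) (g y)))
        (sF 0F) → *-cancelʳ-≢0 D≢0 (trans (cramer₁ c₀ c₁ (f y) (g y) (f y′) (g y′)) (eliminate (- f y′) (- f y)))
      where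
      c₀ = c 0F
      c₁ = c (sF 0F)
      s : Vertex n → ℚ
      s x = c₀ * f x + (c₁ * g x + 0ℚ)
      eliminate : ∀ u v → u * s y - v * s y′ ≡ 0ℚ
      eliminate u v = trans (cong₂ (λ a b → u * a - v * b) (vanishes y) (vanishes y′)) (zero₂ u v)
        where
        zero₂ : ∀ u v → u * 0ℚ - v * 0ℚ ≡ 0ℚ
        zero₂ = solve-∀ ℚ-ring
      cramer₀ : ∀ a b fy gy fy′ gy′ →
        a * (fy * gy′ - gy * fy′) ≡ gy′ * (a * fy + (b * gy + 0ℚ)) - gy * (a * fy′ + (b * gy′ + 0ℚ))
      cramer₀ = solve-∀ ℚ-ring
      cramer₁ : ∀ a b fy gy fy′ gy′ →
        b * (fy * gy′ - gy * fy′) ≡ (- fy′) * (a * fy + (b * gy + 0ℚ)) - (- fy) * (a * fy′ + (b * gy′ + 0ℚ))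
      cramer₁ = solve-∀ ℚ-ring

    nonsingularMinor⇒nonzero : NonsingularMinor f g → Nonzero f
    nonsingularMinor⇒nonzero ((y , y′) , D≢0) with f y ℚₚ.≟ 0ℚ | f y′ ℚₚ.≟ 0ℚ
    ... | no fy≢0  | _          = y , fy≢0
    ... | yes _    | no fy′≢0   = y′ , fy′≢0
    ... | yes fy≡0 | yes fy′≡0  = ⊥-elim (D≢0 (trans (cong₂ (λ a b → a * g y′ - g y * b) fy≡0 fy′≡0) (vanish (g y′) (g y))))
      where
      vanish : ∀ u v → 0ℚ * u - v * 0ℚ ≡ 0ℚ
      vanish = solve-∀ ℚ-ring

  1-2ε≢0 : ∀ {ε} → ε ≡ 1ℚ ⊎ ε ≡ - 1ℚ → 1ℚ - 2ℚ * ε ≢ 0ℚ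
  1-2ε≢0 (inj₁ refl) ()
  1-2ε≢0 (inj₂ refl) ()

  -- At (k, 0, n − k) and (0, k, n − k) the minor is 1 − 2 d(n − k) ∈ {−1, 3}. This uses d(0) = 0,
  -- which fails for k = 0, so n = 1 is settled by computation.
  Rvec-nonsingular : ∀ n k → n ≡ k ℕ.+ k ⊎ n ≡ suc (k ℕ.+ k) → 1 ≤ n →
    NonsingularMinor (Rvec n k) (actVec swap₁₂ (Rvec n k))
  Rvec-nonsingular .0 zero    (inj₁ refl) ()
  Rvec-nonsingular .1 zero    (inj₂ refl) _ = ((mkTriple 1 0 0 , refl) , (mkTriple 0 1 0 , refl)) , λ ()
  Rvec-nonsingular n  (suc k) n≡2k+ε _ = (y , y′) , minor≢0
    where
    k≤n : suc k ≤ n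
    k≤n = [ (λ n≡2k → subst (suc k ≤_) (sym n≡2k) (ℕₚ.m≤m+n (suc k) (suc k)))
          , (λ n≡2k+1 → subst (suc k ≤_) (sym n≡2k+1) (ℕₚ.m≤n⇒m≤1+n (ℕₚ.m≤m+n (suc k) (suc k)))) ]′ n≡2k+ε
    y y′ : Vertex n
    y  = mkTriple (suc k) 0 (n ∸ suc k) , trans (cong (ℕ._+ (n ∸ suc k)) (ℕₚ.+-identityʳ (suc k))) (ℕₚ.m+[n∸m]≡n k≤n)
    y′ = mkTriple 0 (suc k) (n ∸ suc k) , ℕₚ.m+[n∸m]≡n k≤n
    ε = dipole (suc k) (n ∸ suc k)
    ε-values : ε ≡ 1ℚ ⊎ ε ≡ - 1ℚ
    ε-values = [ (λ n≡2k → inj₁ (trans (cong (dipole (suc k)) (∸-half-even {k = suc k} n≡2k)) (dipole-self (suc k))))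
               , (λ n≡2k+1 → inj₂ (trans (cong (dipole (suc k)) (∸-half-odd {k = suc k} n≡2k+1)) (dipole-suc (suc k)))) ]′ n≡2k+ε
    minor-value : minor (Rvec n (suc k)) (actVec swap₁₂ (Rvec n (suc k))) y y′ ≡ 1ℚ - 2ℚ * ε
    minor-value = begin
      minor (Rvec n (suc k)) (actVec swap₁₂ (Rvec n (suc k))) y y′
        ≡⟨ cong₂ _-_ (cong₂ _*_ (Rvec-dipole n (suc k) y) (actVec-Rvec n (suc k) swap₁₂ y′))
                     (cong₂ _*_ (actVec-Rvec n (suc k) swap₁₂ y) (Rvec-dipole n (suc k) y′)) ⟩
      (d - 0ℚ) * (0ℚ - ε) - (d - ε) * (0ℚ - d)
        ≡⟨ cong (λ u → (u - 0ℚ) * (0ℚ - ε) - (u - ε) * (0ℚ - u)) (dipole-self (suc k)) ⟩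
      (1ℚ - 0ℚ) * (0ℚ - ε) - (1ℚ - ε) * (0ℚ - 1ℚ)
        ≡⟨ simplify ε ⟩
      1ℚ - 2ℚ * ε  ∎
      where
      d = dipole (suc k) (suc k)
      simplify : ∀ e → (1ℚ - 0ℚ) * (0ℚ - e) - (1ℚ - e) * (0ℚ - 1ℚ) ≡ 1ℚ - 2ℚ * e
      simplify = solve-∀ ℚ-ring
    minor≢0 : minor (Rvec n (suc k)) (actVec swap₁₂ (Rvec n (suc k))) y y′ ≢ 0ℚ
    minor≢0 D≡0 = 1-2ε≢0 ε-values (trans (sym minor-value) D≡0)

open import Data.Nat using (ℕ; suc; _≥_; _/_; _%_)
open import Data.Integer using (+_; _-_)
open import Data.Rational using () renaming (_/_ to _/ℚ_)
open import Data.Product using (_×_; _,_)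
open import Data.Fin.Permutation using (Permutation′)
open import Relation.Binary.PropositionalEquality using (_≡_)

proposition2p8 : (n : ℕ) → n ≥ 1 →
    Nonzero (Rvec n (n / 2))
    × (n % 2 ≡ 0 → IsEigenvector n (Rvec n (n / 2)) ((+ n - + (n / 2) - + 3) /ℚ 1))
    × (n % 2 ≡ 1 → IsEigenvector n (Rvec n (n / 2)) ((+ n - + (n / 2) - + 2) /ℚ 1))
    × SpanDim {n} {Permutation′ 3} (λ τ → actVec τ (Rvec n (n / 2))) 2
proposition2p8 n n≥1 =
    nonsingularMinor⇒nonzero R τR nonsingular
  , (λ n%2≡0 → Rvec-eigenvector-even n (n / 2) (half-even n n%2≡0))
  , (λ n%2≡1 → Rvec-eigenvector-odd n (n / 2) (half-odd n n%2≡1))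
  , ( orbitBasis n (n / 2)
    , basis-in-orbitSpan n (n / 2)
    , nonsingularMinor⇒linIndep R τR nonsingular
    , orbit-in-basisSpan n (n / 2))
  where
  R τR : Vec n
  R  = Rvec n (n / 2)
  τR = actVec swap₁₂ R
  nonsingular : NonsingularMinor R τR
  nonsingular = Rvec-nonsingular n (n / 2) (half-parity n) n≥1
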